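{- There exists a constant $\varepsilon>0$ such that, both in the existential uncertainty model and in the locational uncertainty model, there are sets $\mathcal{P}$ of $n$ stochastic points for which no $\varepsilon$-exp-kernel of size $o(n)$ satisfying the subset constraint exists; that is, there is no function $g(n)=o(n)$ such that every such $\mathcal{P}$ admits an $\varepsilon$-exp-kernel satisfying the subset constraint of size at most $g(n)$.
   Context: Existential model: each of $n$ points $v$ in $\mathbb{R}^d$ is present independently with probability $p_v$. Locational model: each of $n$ points is always present at a random location, independently, according to a finite discrete distribution. For a finite point set $P$, $f(P,u)=\max_{p\in P}\langle u,p\rangle$ (with $f(\emptyset,u)=0$), $\omega(P,u)=f(P,u)+f(P,-u)$, and for stochastic $\mathcal{P}$, $\omega(\mathcal{P},u)=\mathbb{E}_{P\sim\mathcal{P}}[\omega(P,u)]$. A set $S$ is an $\varepsilon$-exp-kernel of $\mathcal{P}$ if $(1-\varepsilon)\omega(\mathcal{P},u)\le\omega(S,u)\le\omega(\mathcal{P},u)$ for all $u$. The subset constraint requires that $S$ be a subset of the stochastic points of $\mathcal{P}$, each chosen point keeping its original probability distribution (and independence). -}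

module Defs where

open import Data.Nat as ℕ using (ℕ)
open import Data.Rational using (ℚ; 0ℚ; 1ℚ; _+_; _*_; _-_; -_; _⊔_; _≤_; _<_)
import Data.Rational as ℚ
open import Data.Integer using (+_)
open import Data.Vec using (Vec; []; _∷_)
import Data.Vec as Vec
open import Data.List using (List; []; _∷_; foldr; length; map)
open import Data.List.Relation.Unary.All using (All)
open import Data.List.Relation.Binary.Sublist.Propositional using (_⊆_)
open import Data.Product using (Σ; _×_; _,_; proj₂)
open import Relation.Nullary using (¬_)
open import Relation.Binary.PropositionalEquality using (_≡_)

Point : ℕ → Set
Point d = Vec ℚ d

⟨_,_⟩ : ∀ {d} → Point d → Point d → ℚ
⟨ [] , [] ⟩ = 0ℚ
⟨ x ∷ xs , y ∷ ys ⟩ = x * y + ⟨ xs , ys ⟩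

negV : ∀ {d} → Point d → Point d
negV = Vec.map (λ x → - x)

f : ∀ {d} → List (Point d) → Point d → ℚ
f [] u = 0ℚ
f (p ∷ ps) u = foldr (λ q m → ⟨ u , q ⟩ ⊔ m) ⟨ u , p ⟩ ps

ω : ∀ {d} → List (Point d) → Point d → ℚ
ω P u = f P u + f P (negV u)

-- Existential model: a stochastic point is (location v , probability p_v)

ExPoint : ℕ → Set
ExPoint d = Point d × ℚ

ValidExPoint : ∀ {d} → ExPoint d → Set
ValidExPoint (v , p) = (0ℚ ≤ p) × (p ≤ 1ℚ)

ValidEx : ∀ {d} → List (ExPoint d) → Set
ValidEx 𝒫 = All ValidExPoint 𝒫

-- E_{P∼𝒫}[F(P)], points present independently
expEx : ∀ {d} → List (ExPoint d) → (List (Point d) → ℚ) → ℚ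
expEx [] F = F []
expEx ((v , p) ∷ rest) F =
  p * expEx rest (λ Q → F (v ∷ Q)) + (1ℚ - p) * expEx rest F

ωEx : ∀ {d} → List (ExPoint d) → Point d → ℚ
ωEx 𝒫 u = expEx 𝒫 (λ P → ω P u)

-- Locational model: a stochastic point is a finite discrete distribution
-- given as a list of (location , probability)

LocPoint : ℕ → Set
LocPoint d = List (Point d × ℚ)

ValidLocPoint : ∀ {d} → LocPoint d → Set
ValidLocPoint D = All (λ vq → 0ℚ ≤ proj₂ vq) D × (foldr _+_ 0ℚ (map proj₂ D) ≡ 1ℚ)

ValidLoc : ∀ {d} → List (LocPoint d) → Set
ValidLoc 𝒫 = All ValidLocPoint 𝒫

expLoc : ∀ {d} → List (LocPoint d) → (List (Point d) → ℚ) → ℚ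
expLoc [] F = F []
expLoc (D ∷ rest) F =
  foldr (λ vq acc → proj₂ vq * expLoc rest (λ Q → F (Data.Product.proj₁ vq ∷ Q)) + acc) 0ℚ D

ωLoc : ∀ {d} → List (LocPoint d) → Point d → ℚ
ωLoc 𝒫 u = expLoc 𝒫 (λ P → ω P u)

IsExpKernel : ∀ {d} {A : Set} → (List A → Point d → ℚ) → ℚ → List A → List A → Set
IsExpKernel {d} W ε S 𝒫 =
  ∀ (u : Point d) → ((1ℚ - ε) * W 𝒫 u ≤ W S u) × (W S u ≤ W 𝒫 u)

LittleO : (ℕ → ℕ) → Set
LittleO g = ∀ (δ : ℚ) → 0ℚ < δ →
  Σ ℕ λ N → ∀ n → N ℕ.≤ n → (+ g n ℚ./ 1) ≤ δ * (+ n ℚ./ 1)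

SubsetKernelBound : ∀ {d} {A : Set} → (List A → Set) → (List A → Point d → ℚ)
  → ℚ → (ℕ → ℕ) → Set
SubsetKernelBound {d} {A} Valid W ε g =
  ∀ (𝒫 : List A) → Valid 𝒫 →
    Σ (List A) λ S → (S ⊆ 𝒫) × (length S ℕ.≤ g (length 𝒫)) × IsExpKernel W ε S 𝒫

NoSublinearSubsetKernel : ∀ {d} {A : Set} → (List A → Set) → (List A → Point d → ℚ) → ℚ → Set
NoSublinearSubsetKernel Valid W ε =
  ¬ (Σ (ℕ → ℕ) λ g → LittleO g × SubsetKernelBound Valid W ε g)

-- The hard instance lives on the line.  It consists of one point surely at 0
-- and M "coins": stochastic points that lie at 1 with probability p = 1/M
-- (existential model: otherwise absent; locational model: otherwise at 0).
-- In direction u = 1 an outcome containing 0 has width 1 exactly when some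
-- coin shows 1, so the instance has expected width 1 - (1 - p)^M ≥ 1/2 by
-- Bernoulli's inequality.  Every sub-collection S of these stochastic points
-- has expected width at most |S|·p by the union bound, which for a kernel of
-- size o(n) is eventually ≤ (M + 1)/(10 M) ≤ 1/5 < (1 - ε)/2 with ε = 1/2.
module Submission where

open import Defs
open import Data.Nat as ℕ using (ℕ; zero; suc)
import Data.Nat.Properties as ℕP
import Data.Nat.Coprimality as Coprime
open import Data.Integer as ℤ using (+_)
import Data.Integer.Properties as ℤP
import Data.Integer.Solver as ℤSolver
open import Data.Rational
open import Data.Rational.Properties
import Data.Rational.Unnormalised as U
import Data.Rational.Unnormalised.Properties as UP
open import Data.Rational.Solver using (module +-*-Solver)
open import Data.Vec using ([]; _∷_)
open import Data.List using (List; []; _∷_; _++_; foldr; length; replicate)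
open import Data.List.Properties using (length-replicate)
open import Data.List.Relation.Unary.All as All using (All; []; _∷_)
open import Data.List.Relation.Unary.Any using (here; there)
open import Data.List.Membership.Propositional using (_∈_)
open import Data.List.Relation.Binary.Sublist.Propositional.Properties using (All-resp-⊆)
open import Data.Bool using (Bool; if_then_else_)
open import Data.Product using (Σ; _×_; _,_; proj₁)
open import Data.Sum using (_⊎_; inj₁; inj₂)
open import Relation.Nullary using (does; ¬_)
open import Relation.Nullary.Decidable using (toWitness; True)
open import Relation.Binary.PropositionalEquality

by-computation : (a b : ℚ) → {True (a ≤? b)} → a ≤ b
by-computation a b {t} = toWitness t

by-computation< : (a b : ℚ) → {True (a <? b)} → a < b
by-computation< a b {t} = toWitness t

*-nonneg : ∀ {a b} → 0ℚ ≤ a → 0ℚ ≤ b → 0ℚ ≤ a * b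
*-nonneg {a} {b} 0≤a 0≤b =
  nonNegative⁻¹ (a * b) {{nonNeg*nonNeg⇒nonNeg a {{nonNegative 0≤a}} b {{nonNegative 0≤b}}}}

0≤1-p : ∀ {p} → p ≤ 1ℚ → 0ℚ ≤ 1ℚ - p
0≤1-p {p} p≤1 = subst (_≤ 1ℚ - p) (+-inverseʳ p) (+-monoˡ-≤ (- p) p≤1)

fromℕ : ℕ → ℚ
fromℕ n = + n / 1

-- Since n and 1 are coprime, + n / 1 is already in normal form.
fromℕ-normal : ∀ n → fromℕ n ≡ mkℚ (+ n) 0 (Coprime.sym (Coprime.1-coprimeTo n))
fromℕ-normal n = normalize-coprime (Coprime.sym (Coprime.1-coprimeTo n))

fromℕ-suc : ∀ k → fromℕ (suc k) ≡ 1ℚ + fromℕ k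
fromℕ-suc k = toℚᵘ-injective (begin
  toℚᵘ (fromℕ (suc k))                ≡⟨ cong toℚᵘ (fromℕ-normal (suc k)) ⟩
  U.mkℚᵘ (+ suc k) 0                  ≈⟨ U.*≡* (solve 1 (λ n → (con (+ 1) :+ n) :* (con (+ 1) :* con (+ 1))
                                                  := (con (+ 1) :* con (+ 1) :+ n :* con (+ 1)) :* con (+ 1)) refl (+ k)) ⟩
  U.mkℚᵘ (+ 1) 0 U.+ U.mkℚᵘ (+ k) 0   ≡⟨ cong (λ q → toℚᵘ 1ℚ U.+ toℚᵘ q) (fromℕ-normal k) ⟨
  toℚᵘ 1ℚ U.+ toℚᵘ (fromℕ k)          ≈⟨ toℚᵘ-homo-+ 1ℚ (fromℕ k) ⟨
  toℚᵘ (1ℚ + fromℕ k)                 ∎)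
  where
  open UP.≃-Reasoning
  open ℤSolver.+-*-Solver

fromℕ-mono : ∀ {m n} → m ℕ.≤ n → fromℕ m ≤ fromℕ n
fromℕ-mono {m} {n} m≤n rewrite fromℕ-normal m | fromℕ-normal n =
  *≤* (subst₂ ℤ._≤_ (sym (ℤP.*-identityʳ (+ m))) (sym (ℤP.*-identityʳ (+ n))) (ℤ.+≤+ m≤n))

reciprocal : ∀ M → .{{ℕ.NonZero M}} → Σ ℚ λ p → 0ℚ ≤ p × p ≤ 1ℚ × fromℕ M * p ≡ 1ℚ
reciprocal (suc N) =
  1/ m , nonNegative⁻¹ (1/ m) , *≤* (ℤ.+≤+ (ℕ.s≤s ℕ.z≤n)) ,
  trans (cong (_* 1/ m) (fromℕ-normal (suc N))) (*-inverseʳ m)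
  where
  m : ℚ
  m = mkℚ (+ suc N) 0 (Coprime.sym (Coprime.1-coprimeTo (suc N)))

infixr 8 _^_
_^_ : ℚ → ℕ → ℚ
x ^ zero  = 1ℚ
x ^ suc k = x * x ^ k

^-nonneg : ∀ {x} → 0ℚ ≤ x → ∀ k → 0ℚ ≤ x ^ k
^-nonneg 0≤x zero    = by-computation 0ℚ 1ℚ
^-nonneg 0≤x (suc k) = *-nonneg 0≤x (^-nonneg 0≤x k)

-- Each step multiplies by (1 - p)(1 + (k+1)p)/(1 + kp) ≤ 1, since
-- (1 - p)(1 + kp + p) = (1 + kp) - p²(k + 1).
bernoulli : ∀ {p} → 0ℚ ≤ p → p ≤ 1ℚ → ∀ k → (1ℚ - p) ^ k * (1ℚ + fromℕ k * p) ≤ 1ℚ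
bernoulli {p} 0≤p p≤1 zero = ≤-reflexive (solve 1 (λ p → con 1ℚ :* (con 1ℚ :+ con 0ℚ :* p) := con 1ℚ) refl p)
  where open +-*-Solver
bernoulli {p} 0≤p p≤1 (suc k) = begin
  (1ℚ - p) ^ suc k * (1ℚ + fromℕ (suc k) * p)                  ≡⟨ cong (λ t → (1ℚ - p) ^ suc k * (1ℚ + t * p)) (fromℕ-suc k) ⟩
  (1ℚ - p) * x * (1ℚ + (1ℚ + fromℕ k) * p)                     ≡⟨ step-identity x (fromℕ k) ⟩
  x * (1ℚ + fromℕ k * p) - x * (p * p * (1ℚ + fromℕ k))       ≤⟨ +-monoʳ-≤ (x * (1ℚ + fromℕ k * p)) (neg-antimono-≤ loss≥0) ⟩
  x * (1ℚ + fromℕ k * p) + - 0ℚ                                ≡⟨ +-identityʳ (x * (1ℚ + fromℕ k * p)) ⟩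
  x * (1ℚ + fromℕ k * p)                                       ≤⟨ bernoulli 0≤p p≤1 k ⟩
  1ℚ                                                           ∎
  where
  open ≤-Reasoning
  open +-*-Solver
  x : ℚ
  x = (1ℚ - p) ^ k
  step-identity : ∀ x n → (1ℚ - p) * x * (1ℚ + (1ℚ + n) * p) ≡ x * (1ℚ + n * p) - x * (p * p * (1ℚ + n))
  step-identity x n = solve 3 (λ x n p → (con 1ℚ :- p) :* x :* (con 1ℚ :+ (con 1ℚ :+ n) :* p)
                                       := x :* (con 1ℚ :+ n :* p) :- x :* (p :* p :* (con 1ℚ :+ n))) refl x n p
  loss≥0 : 0ℚ ≤ x * (p * p * (1ℚ + fromℕ k))
  loss≥0 = *-nonneg (^-nonneg (0≤1-p p≤1) k)
             (*-nonneg (*-nonneg 0≤p 0≤p) (subst (0ℚ ≤_) (fromℕ-suc k) (fromℕ-mono {0} {suc k} ℕ.z≤n)))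

-- For P = p ∷ ps, f P u unfolds to  maxFrom u ⟨ u , p ⟩ ps.
maxFrom : ∀ {d} → Point d → ℚ → List (Point d) → ℚ
maxFrom u = foldr (λ q m → ⟨ u , q ⟩ ⊔ m)

maxFrom-init : ∀ {d} (u : Point d) init ps → init ≤ maxFrom u init ps
maxFrom-init u init []       = ≤-refl
maxFrom-init u init (q ∷ ps) = ≤-trans (maxFrom-init u init ps) (p≤q⊔p ⟨ u , q ⟩ _)

maxFrom-elem : ∀ {d} (u : Point d) init {q ps} → q ∈ ps → ⟨ u , q ⟩ ≤ maxFrom u init ps
maxFrom-elem u init {ps = q ∷ ps}  (here refl) = p≤p⊔q ⟨ u , q ⟩ _
maxFrom-elem u init {ps = q′ ∷ ps} (there q∈) = ≤-trans (maxFrom-elem u init q∈) (p≤q⊔p ⟨ u , q′ ⟩ _)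

maxFrom-lub : ∀ {d} (u : Point d) {init b} ps → init ≤ b → All (λ q → ⟨ u , q ⟩ ≤ b) ps → maxFrom u init ps ≤ b
maxFrom-lub u []       init≤b []           = init≤b
maxFrom-lub u (q ∷ ps) init≤b (q≤b ∷ ps≤b) = ⊔-lub q≤b (maxFrom-lub u ps init≤b ps≤b)

f-ub : ∀ {d} (u : Point d) {q P} → q ∈ P → ⟨ u , q ⟩ ≤ f P u
f-ub u {P = p ∷ ps} (here refl) = maxFrom-init u ⟨ u , p ⟩ ps
f-ub u {P = p ∷ ps} (there q∈)  = maxFrom-elem u ⟨ u , p ⟩ q∈

f-lub : ∀ {d} (u : Point d) {b p ps} → All (λ q → ⟨ u , q ⟩ ≤ b) (p ∷ ps) → f (p ∷ ps) u ≤ b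
f-lub u {ps = ps} (p≤b ∷ ps≤b) = maxFrom-lub u ps p≤b ps≤b

o0 o1 u1 : Point 1
o0 = 0ℚ ∷ []
o1 = 1ℚ ∷ []
u1 = 1ℚ ∷ []

Among : {X : Set} → X → X → List X → Set
Among a b = All (λ x → x ≡ a ⊎ x ≡ b)

Binary : List (Point 1) → Set
Binary = Among o0 o1

isOne : Point 1 → Bool
isOne (x ∷ []) = does (x ≟ 1ℚ)

hitsOne : List (Point 1) → ℚ
hitsOne []      = 0ℚ
hitsOne (v ∷ Q) = if isOne v then 1ℚ else hitsOne Q

hitsOne-cases : ∀ {Q} → Binary Q → (hitsOne Q ≡ 1ℚ × o1 ∈ Q) ⊎ (hitsOne Q ≡ 0ℚ × All (_≡ o0) Q)
hitsOne-cases []                 = inj₂ (refl , [])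
hitsOne-cases (inj₂ refl ∷ _)    = inj₁ (refl , here refl)
hitsOne-cases (inj₁ refl ∷ bQ) with hitsOne-cases bQ
... | inj₁ (h≡1 , o1∈) = inj₁ (h≡1 , there o1∈)
... | inj₂ (h≡0 , all0) = inj₂ (h≡0 , refl ∷ all0)

hitsOne-nonneg : ∀ {Q} → Binary Q → 0ℚ ≤ hitsOne Q
hitsOne-nonneg bQ with hitsOne-cases bQ
... | inj₁ (h≡1 , _) = subst (0ℚ ≤_) (sym h≡1) (by-computation 0ℚ 1ℚ)
... | inj₂ (h≡0 , _) = ≤-reflexive (sym h≡0)

zeros-binary : ∀ {Z Q} → All (_≡ o0) Z → Binary Q → Binary (Z ++ Q)
zeros-binary []         bQ = bQ
zeros-binary (refl ∷ z) bQ = inj₁ refl ∷ zeros-binary z bQ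

zeros-hits : ∀ {Z} → All (_≡ o0) Z → ∀ Q → hitsOne (Z ++ Q) ≡ hitsOne Q
zeros-hits []         Q = refl
zeros-hits (refl ∷ z) Q = zeros-hits z Q

width≤hitsOne : ∀ {Q} → Binary Q → ω Q u1 ≤ hitsOne Q
width≤hitsOne {[]} [] = ≤-refl
width≤hitsOne {v ∷ Q} bQ =
  subst (ω (v ∷ Q) u1 ≤_) (+-identityʳ (hitsOne (v ∷ Q))) (+-mono-≤ top bottom)
  where
  top : f (v ∷ Q) u1 ≤ hitsOne (v ∷ Q)
  top with hitsOne-cases bQ
  ... | inj₁ (h≡1 , _) = subst (f (v ∷ Q) u1 ≤_) (sym h≡1)
          (f-lub u1 (All.map (λ { (inj₁ refl) → by-computation 0ℚ 1ℚ ; (inj₂ refl) → ≤-refl }) bQ))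
  ... | inj₂ (h≡0 , all0) = subst (f (v ∷ Q) u1 ≤_) (sym h≡0)
          (f-lub u1 (All.map (λ { refl → ≤-refl }) all0))
  bottom : f (v ∷ Q) (negV u1) ≤ 0ℚ
  bottom = f-lub (negV u1) (All.map (λ { (inj₁ refl) → ≤-refl ; (inj₂ refl) → by-computation (- 1ℚ) 0ℚ }) bQ)

hitsOne≤width : ∀ {Q} → Binary Q → hitsOne Q ≤ ω (o0 ∷ Q) u1
hitsOne≤width {Q} bQ = subst (_≤ ω (o0 ∷ Q) u1) (+-identityʳ (hitsOne Q)) (+-mono-≤ top (f-ub (negV u1) {P = o0 ∷ Q} (here refl)))
  where
  top : hitsOne Q ≤ f (o0 ∷ Q) u1
  top with hitsOne-cases bQ
  ... | inj₁ (h≡1 , o1∈) = subst (_≤ f (o0 ∷ Q) u1) (sym h≡1) (f-ub u1 {P = o0 ∷ Q} (there o1∈))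
  ... | inj₂ (h≡0 , _)   = subst (_≤ f (o0 ∷ Q) u1) (sym h≡0) (f-ub u1 {P = o0 ∷ Q} (here refl))

-- A model of stochastic points A, with validity predicate and expectation
-- operator E, can flip p-coins if it has a point surely at 0 and a point at 1
-- with probability p which otherwise contributes only copies of 0 (none in
-- the existential model, one in the locational model).
record CoinPoints {A : Set} (Valid : List A → Set) (E : List A → (List (Point 1) → ℚ) → ℚ) (p : ℚ) : Set where
  field
    sure0 coin    : A
    failure       : List (Point 1)
    failure-zeros : All (_≡ o0) failure
    E-[]    : ∀ F → E [] F ≡ F []
    E-sure0 : ∀ L F → E (sure0 ∷ L) F ≡ E L (λ Q → F (o0 ∷ Q))
    E-coin  : ∀ L F → E (coin ∷ L) F ≡ p * E L (λ Q → F (o1 ∷ Q)) + (1ℚ - p) * E L (λ Q → F (failure ++ Q))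
    valid   : ∀ {L} → Among sure0 coin L → Valid L

module CoinArgument {A : Set} {Valid : List A → Set} {E : List A → (List (Point 1) → ℚ) → ℚ} {p : ℚ}
                    (C : CoinPoints Valid E p) (0≤p : 0ℚ ≤ p) (p≤1 : p ≤ 1ℚ) where
  open CoinPoints C
  open +-*-Solver

  -- The stochastic sets the argument deals with: the instance and its subsets.
  Built : List A → Set
  Built = Among sure0 coin

  -- Over lists of sure points and coins, E only sees 0/1 outcomes, and it is monotone there.
  E-mono : ∀ {L} → Built L → ∀ {F G} → (∀ {Q} → Binary Q → F Q ≤ G Q) → E L F ≤ E L G
  E-mono {[]} [] {F} {G} F≤G rewrite E-[] F | E-[] G = F≤G []
  E-mono {_ ∷ L} (inj₁ refl ∷ bL) {F} {G} F≤G rewrite E-sure0 L F | E-sure0 L G =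
    E-mono bL (λ bQ → F≤G (inj₁ refl ∷ bQ))
  E-mono {_ ∷ L} (inj₂ refl ∷ bL) {F} {G} F≤G rewrite E-coin L F | E-coin L G =
    +-mono-≤ (*-monoˡ-≤-nonNeg p {{nonNegative 0≤p}} (E-mono bL (λ bQ → F≤G (inj₂ refl ∷ bQ))))
             (*-monoˡ-≤-nonNeg (1ℚ - p) {{nonNegative (0≤1-p p≤1)}} (E-mono bL (λ bQ → F≤G (zeros-binary failure-zeros bQ))))

  E-cong : ∀ {L} → Built L → ∀ {F G} → (∀ {Q} → Binary Q → F Q ≡ G Q) → E L F ≡ E L G
  E-cong bL F≡G = ≤-antisym (E-mono bL (λ bQ → ≤-reflexive (F≡G bQ))) (E-mono bL (λ bQ → ≤-reflexive (sym (F≡G bQ))))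

  failure-invisible : ∀ {L} → Built L → E L (λ Q → hitsOne (failure ++ Q)) ≡ E L hitsOne
  failure-invisible bL = E-cong bL (λ {Q} _ → zeros-hits failure-zeros Q)

  -- The probabilities of a coin add up to one.
  E-const : ∀ {L} → Built L → ∀ k → E L (λ _ → k) ≡ k
  E-const {[]} [] k = E-[] _
  E-const {_ ∷ L} (inj₁ refl ∷ bL) k = trans (E-sure0 L _) (E-const bL k)
  E-const {_ ∷ L} (inj₂ refl ∷ bL) k = begin
    E (coin ∷ L) (λ _ → k)                       ≡⟨ E-coin L _ ⟩
    p * E L (λ _ → k) + (1ℚ - p) * E L (λ _ → k) ≡⟨ cong (λ e → p * e + (1ℚ - p) * e) (E-const bL k) ⟩
    p * k + (1ℚ - p) * k                         ≡⟨ solve 2 (λ p k → p :* k :+ (con 1ℚ :- p) :* k := k) refl p k ⟩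
    k                                            ∎
    where open ≡-Reasoning

  hits-nonneg : ∀ {L} → Built L → 0ℚ ≤ E L hitsOne
  hits-nonneg {L} bL = subst (_≤ E L hitsOne) (E-const bL 0ℚ) (E-mono bL hitsOne-nonneg)

  -- Adding a coin raises the union bound by p.
  coin-step : ∀ {X} k → 0ℚ ≤ X → X ≤ fromℕ k * p → p * 1ℚ + (1ℚ - p) * X ≤ fromℕ (suc k) * p
  coin-step {X} k 0≤X X≤kp = begin
    p * 1ℚ + (1ℚ - p) * X ≤⟨ +-monoʳ-≤ (p * 1ℚ) (*-monoʳ-≤-nonNeg X {{nonNegative 0≤X}} 1-p≤1) ⟩
    p * 1ℚ + 1ℚ * X       ≤⟨ +-monoʳ-≤ (p * 1ℚ) (≤-trans (≤-reflexive (*-identityˡ X)) X≤kp) ⟩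
    p * 1ℚ + fromℕ k * p  ≡⟨ solve 2 (λ p n → p :* con 1ℚ :+ n :* p := (con 1ℚ :+ n) :* p) refl p (fromℕ k) ⟩
    (1ℚ + fromℕ k) * p    ≡⟨ cong (_* p) (fromℕ-suc k) ⟨
    fromℕ (suc k) * p     ∎
    where
    open ≤-Reasoning
    1-p≤1 : 1ℚ - p ≤ 1ℚ
    1-p≤1 = subst (1ℚ - p ≤_) (+-identityʳ 1ℚ) (+-monoʳ-≤ 1ℚ (neg-antimono-≤ 0≤p))

  union-bound : ∀ {L} → Built L → E L hitsOne ≤ fromℕ (length L) * p
  union-bound {[]} [] rewrite E-[] hitsOne = ≤-reflexive (sym (*-zeroˡ p))
  union-bound {_ ∷ L} (inj₁ refl ∷ bL) rewrite E-sure0 L hitsOne =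
    ≤-trans (union-bound bL) (*-monoʳ-≤-nonNeg p {{nonNegative 0≤p}} (fromℕ-mono (ℕP.n≤1+n (length L))))
  union-bound {_ ∷ L} (inj₂ refl ∷ bL) rewrite E-coin L hitsOne | E-const bL 1ℚ | failure-invisible bL =
    coin-step (length L) (hits-nonneg bL) (union-bound bL)

  coins : ℕ → List A
  coins k = replicate k coin

  coins-built : ∀ k → Built (coins k)
  coins-built zero    = []
  coins-built (suc k) = inj₂ refl ∷ coins-built k

  hits-coins : ∀ k → E (coins k) hitsOne ≡ 1ℚ - (1ℚ - p) ^ k
  hits-coins zero = E-[] hitsOne
  hits-coins (suc k) = begin
    E (coin ∷ coins k) hitsOne
      ≡⟨ E-coin (coins k) hitsOne ⟩
    p * E (coins k) (λ _ → 1ℚ) + (1ℚ - p) * E (coins k) (λ Q → hitsOne (failure ++ Q))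
      ≡⟨ cong₂ (λ a b → p * a + (1ℚ - p) * b) (E-const built 1ℚ) (trans (failure-invisible built) (hits-coins k)) ⟩
    p * 1ℚ + (1ℚ - p) * (1ℚ - (1ℚ - p) ^ k)
      ≡⟨ solve 2 (λ p x → p :* con 1ℚ :+ (con 1ℚ :- p) :* (con 1ℚ :- x) := con 1ℚ :- (con 1ℚ :- p) :* x) refl p ((1ℚ - p) ^ k) ⟩
    1ℚ - (1ℚ - p) ^ suc k
      ∎
    where
    open ≡-Reasoning
    built : Built (coins k)
    built = coins-built k

  width : List A → Point 1 → ℚ
  width L u = E L (λ P → ω P u)

  hard : ℕ → List A
  hard k = sure0 ∷ coins k

  hard-built : ∀ k → Built (hard k)
  hard-built k = inj₁ refl ∷ coins-built k

  -- The instance is wide in direction 1: the sure 0 makes every coin showing 1 count.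
  hard-width : ∀ k → 1ℚ - (1ℚ - p) ^ k ≤ width (hard k) u1
  hard-width k rewrite E-sure0 (coins k) (λ P → ω P u1) | sym (hits-coins k) =
    E-mono (coins-built k) hitsOne≤width

  subset-width : ∀ {S} → Built S → width S u1 ≤ fromℕ (length S) * p
  subset-width bS = ≤-trans (E-mono bS width≤hitsOne) (union-bound bS)

-- ε is the constant of the theorem; δ is the ratio |S| / n below which a
-- sublinear kernel eventually falls.
ε δ : ℚ
ε = + 1 / 2
δ = + 1 / 10

half≤hit : ∀ {p} M → 0ℚ ≤ p → p ≤ 1ℚ → fromℕ M * p ≡ 1ℚ → + 1 / 2 ≤ 1ℚ - (1ℚ - p) ^ M
half≤hit {p} M 0≤p p≤1 Mp≡1 = begin
  + 1 / 2                        ≡⟨⟩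
  1ℚ - + 1 / 2 * 1ℚ              ≤⟨ +-monoʳ-≤ 1ℚ (neg-antimono-≤ (*-monoˡ-≤-nonNeg (+ 1 / 2) double-x≤1)) ⟩
  1ℚ - + 1 / 2 * (x * (1ℚ + 1ℚ)) ≡⟨ solve 1 (λ x → con 1ℚ :- con (+ 1 / 2) :* (x :* (con 1ℚ :+ con 1ℚ)) := con 1ℚ :- x) refl x ⟩
  1ℚ - x                         ∎
  where
  open ≤-Reasoning
  open +-*-Solver
  x : ℚ
  x = (1ℚ - p) ^ M
  double-x≤1 : x * (1ℚ + 1ℚ) ≤ 1ℚ
  double-x≤1 = subst (λ t → x * (1ℚ + t) ≤ 1ℚ) Mp≡1 (bernoulli 0≤p p≤1 M)

few-coins : ∀ {p} s M → 0ℚ ≤ p → p ≤ 1ℚ → fromℕ M * p ≡ 1ℚ →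
  fromℕ s ≤ δ * fromℕ (suc M) → fromℕ s * p ≤ δ * (1ℚ + 1ℚ)
few-coins {p} s M 0≤p p≤1 Mp≡1 s≤ = begin
  fromℕ s * p                   ≤⟨ *-monoʳ-≤-nonNeg p {{nonNegative 0≤p}} s≤ ⟩
  δ * fromℕ (suc M) * p         ≡⟨ cong (λ t → δ * t * p) (fromℕ-suc M) ⟩
  δ * (1ℚ + fromℕ M) * p        ≡⟨ solve 2 (λ n p → con δ :* (con 1ℚ :+ n) :* p := con δ :* (p :+ n :* p)) refl (fromℕ M) p ⟩
  δ * (p + fromℕ M * p)         ≡⟨ cong (λ t → δ * (p + t)) Mp≡1 ⟩
  δ * (p + 1ℚ)                  ≤⟨ *-monoˡ-≤-nonNeg δ (+-monoˡ-≤ 1ℚ p≤1) ⟩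
  δ * (1ℚ + 1ℚ)                 ∎
  where
  open ≤-Reasoning
  open +-*-Solver

width-gap : ∀ {W𝒫 WS} → + 1 / 2 ≤ W𝒫 → WS ≤ δ * (1ℚ + 1ℚ) → ¬ ((1ℚ - ε) * W𝒫 ≤ WS)
width-gap {W𝒫} {WS} half≤ WS≤ kernel = <-irrefl refl (begin-strict
  δ * (1ℚ + 1ℚ)      <⟨ by-computation< (δ * (1ℚ + 1ℚ)) ((1ℚ - ε) * (+ 1 / 2)) ⟩
  (1ℚ - ε) * (+ 1 / 2) ≤⟨ *-monoˡ-≤-nonNeg (1ℚ - ε) half≤ ⟩
  (1ℚ - ε) * W𝒫      ≤⟨ kernel ⟩
  WS                 ≤⟨ WS≤ ⟩
  δ * (1ℚ + 1ℚ)      ∎)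
  where open ≤-Reasoning

-- For n = M + 1 ≥ N + 2 the hard instance with M = N + 1 coins of probability
-- p = 1/M would have a kernel S of size ≤ δ n, contradicting width-gap.
noSublinearKernel : ∀ {A : Set} {Valid : List A → Set} {E : List A → (List (Point 1) → ℚ) → ℚ} →
  (∀ {p} → 0ℚ ≤ p → p ≤ 1ℚ → CoinPoints Valid E p) →
  NoSublinearSubsetKernel {1} Valid (λ L u → E L (λ P → ω P u)) ε
noSublinearKernel coinPoints (g , sublinear , kernels)
  with sublinear δ (by-computation< 0ℚ δ)
... | N , g≤δn
  with reciprocal (suc N)
... | p , 0≤p , p≤1 , Mp≡1
  with CoinArgument.hard-built (coinPoints 0≤p p≤1) 0≤p p≤1 (suc N)
... | built
  with kernels _ (CoinPoints.valid (coinPoints 0≤p p≤1) built)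
... | S , S⊆ , |S|≤g , kernel =
  width-gap (≤-trans (half≤hit (suc N) 0≤p p≤1 Mp≡1) (hard-width (suc N)))
            (≤-trans (subset-width (All-resp-⊆ S⊆ built))
                     (few-coins (length S) (suc N) 0≤p p≤1 Mp≡1 size))
            (proj₁ (kernel u1))
  where
  open CoinArgument (coinPoints 0≤p p≤1) 0≤p p≤1
  size : fromℕ (length S) ≤ δ * fromℕ (suc (suc N))
  size = ≤-trans (fromℕ-mono (subst (λ n → length S ℕ.≤ g n) (cong suc (length-replicate (suc N))) |S|≤g))
                 (g≤δn (suc (suc N)) (ℕP.≤-trans (ℕP.n≤1+n N) (ℕP.n≤1+n (suc N))))

existentialCoins : ∀ {p} → 0ℚ ≤ p → p ≤ 1ℚ → CoinPoints (ValidEx {1}) (expEx {1}) p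
existentialCoins {p} 0≤p p≤1 = record
  { sure0   = o0 , 1ℚ
  ; coin    = o1 , p
  ; failure = []
  ; failure-zeros = []
  ; E-[]    = λ F → refl
  ; E-sure0 = λ L F → solve 2 (λ x y → con 1ℚ :* x :+ (con 1ℚ :- con 1ℚ) :* y := x) refl
                        (expEx L (λ Q → F (o0 ∷ Q))) (expEx L F)
  ; E-coin  = λ L F → refl
  ; valid   = All.map λ { (inj₁ refl) → by-computation 0ℚ 1ℚ , ≤-refl ; (inj₂ refl) → 0≤p , p≤1 }
  }
  where open +-*-Solver

locationalCoins : ∀ {p} → 0ℚ ≤ p → p ≤ 1ℚ → CoinPoints (ValidLoc {1}) (expLoc {1}) p
locationalCoins {p} 0≤p p≤1 = record
  { sure0   = (o0 , 1ℚ) ∷ []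
  ; coin    = (o1 , p) ∷ (o0 , 1ℚ - p) ∷ []
  ; failure = o0 ∷ []
  ; failure-zeros = refl ∷ []
  ; E-[]    = λ F → refl
  ; E-sure0 = λ L F → solve 1 (λ x → con 1ℚ :* x :+ con 0ℚ := x) refl (expLoc L (λ Q → F (o0 ∷ Q)))
  ; E-coin  = λ L F → cong (λ t → p * expLoc L (λ Q → F (o1 ∷ Q)) + t) (+-identityʳ _)
  ; valid   = All.map λ
      { (inj₁ refl) → (by-computation 0ℚ 1ℚ ∷ []) , refl
      ; (inj₂ refl) → (0≤p ∷ 0≤1-p p≤1 ∷ []) , solve 1 (λ p → p :+ ((con 1ℚ :- p) :+ con 0ℚ) := con 1ℚ) refl p }
  }
  where open +-*-Solver

mainTheorem9 : Σ ℚ λ ε → (0ℚ < ε) × (Σ ℕ λ d →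
                 NoSublinearSubsetKernel {d} (ValidEx {d}) (ωEx {d}) ε
                 × NoSublinearSubsetKernel {d} (ValidLoc {d}) (ωLoc {d}) ε)
mainTheorem9 =
  ε , by-computation< 0ℚ ε , 1 ,
  noSublinearKernel existentialCoins , noSublinearKernel locationalCoins
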